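{- Let $G$ be a non-trivial connected graph and let $t\ge 2$ be an integer. Let $B$ be a local metric basis of $P_t\boxtimes G$ with $|B|=b$, and let $u_{i_1},u_{i_2},\ldots,u_{i_b}$ be the first components of the elements of $B$ (listed with multiplicity), where $i_1\le i_2\le\cdots\le i_b$. Then: (i) $i_2\le D(G)+1$ and $i_{b-1}\ge t-D(G)$; (ii) for any $l\in\{1,\dots,b-2\}$, $i_{l+2}\le 2D(G)+i_l$; (iii) $i_3\le 2D(G)+1$.
   Context: $P_t$ is the path with vertices $u_1,\dots,u_t$ and $u_i\sim u_{i+1}$ for $1\le i\le t-1$. $D(G)$ is the diameter of $G$. A set $S$ is a local metric generator for a connected graph $X$ if for every two adjacent vertices $x,y$ there is $s\in S$ with $d_X(s,x)\ne d_X(s,y)$; a local metric basis is one of minimum cardinality. The strong product $P_t\boxtimes G$ has vertex set $V(P_t)\times V(G)$, with $(a,b)\sim(c,d)$ iff ($a=c$ and $b\sim d$) or ($b=d$ and $a\sim c$) or ($a\sim c$ and $b\sim d$). -}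

module Defs where

open import Data.Nat using (ℕ; zero; suc; _≤_)
open import Data.Fin using (Fin; toℕ)
open import Data.Product using (Σ; ∃; _×_; _,_)
open import Data.Sum using (_⊎_)
open import Data.List using (List; length)
open import Data.List.Membership.Propositional using (_∈_)
open import Data.List.Relation.Unary.Unique.Propositional using (Unique)
open import Relation.Binary.PropositionalEquality using (_≡_; _≢_)
open import Relation.Nullary using (¬_)

record Graph (n : ℕ) : Set₁ where
  field
    Adj       : Fin n → Fin n → Set
    symmetric : ∀ {x y} → Adj x y → Adj y x
    irreflex  : ∀ {x} → ¬ Adj x x
open Graph public

data Walk {A : Set} (R : A → A → Set) : A → A → ℕ → Set where
  here : ∀ {x} → Walk R x x 0
  step : ∀ {x y z k} → R x y → Walk R y z k → Walk R x z (suc k)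

Dist : {A : Set} → (A → A → Set) → A → A → ℕ → Set
Dist R x y k = Walk R x y k × (∀ m → Walk R x y m → k ≤ m)

Connected : {A : Set} → (A → A → Set) → Set
Connected {A} R = ∀ (x y : A) → ∃ λ k → Walk R x y k

IsDiameter : {A : Set} → (A → A → Set) → ℕ → Set
IsDiameter {A} R D =
  (∀ (x y : A) k → Dist R x y k → k ≤ D) × (Σ A λ x → Σ A λ y → Dist R x y D)

LocalMetricGenerator : {A : Set} → (A → A → Set) → List A → Set
LocalMetricGenerator {A} R S =
  ∀ (x y : A) → R x y →
    Σ A λ s → s ∈ S × Σ ℕ λ k₁ → Σ ℕ λ k₂ → Dist R s x k₁ × Dist R s y k₂ × k₁ ≢ k₂

LocalMetricBasis : {A : Set} → (A → A → Set) → List A → Set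
LocalMetricBasis {A} R B =
  LocalMetricGenerator R B × Unique B ×
  (∀ (S : List A) → LocalMetricGenerator R S → length B ≤ length S)

-- Path P_t on Fin t: vertex a : Fin t stands for u_{toℕ a + 1}.
PathAdj : (t : ℕ) → Fin t → Fin t → Set
PathAdj t a c = suc (toℕ a) ≡ toℕ c ⊎ suc (toℕ c) ≡ toℕ a

StrongAdj : (t : ℕ) {n : ℕ} → Graph n → Fin t × Fin n → Fin t × Fin n → Set
StrongAdj t G (a , b) (c , d) =
  (a ≡ c × Adj G b d) ⊎ (b ≡ d × PathAdj t a c) ⊎ (PathAdj t a c × Adj G b d)

firstIndex : {t n : ℕ} → Fin t × Fin n → ℕ
firstIndex (a , _) = suc (toℕ a)

-- If x ∼ y in G, the vertices (r , x) and (r , y) of P_t ⊠ G lie in one row, and a vertex s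
-- whose column is within |row s − r| steps of both x and y sees them at the same distance
-- |row s − r|. Every vertex at least D rows from r is such a vertex. A single vertex s off
-- row r is defeated by an edge at its own column, and two vertices s₁, s₂ whose row gaps add
-- up to more than D by an edge on a shortest path between their columns. Each bound of the
-- theorem, if it failed, would leave two adjacent rows with at most one basis vertex closer than
-- D rows, or a single row with at most two, and hence an unresolved pair of adjacent vertices.

module Submission where

open import Defs
open import Data.Bool using (true; false)
open import Data.Nat using (ℕ; zero; suc; _≤_; _<_; _+_; _*_; _∸_; z≤n; s≤s; ∣_-_∣; _≤?_; _<?_)
open import Data.Nat.Properties
open import Data.Nat.Induction using (<-rec)
open import Data.Nat.Tactic.RingSolver using (solve-∀)
open import Data.Fin using (Fin; toℕ; fromℕ<) renaming (zero to fzero; suc to fsuc)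
import Data.Fin as Fin
open import Data.Fin.Properties using (toℕ-injective; toℕ<n; toℕ-fromℕ<)
open import Data.Product using (∃; ∃₂; _×_; _,_; proj₁; proj₂)
open import Data.Sum using (_⊎_; inj₁; inj₂)
import Data.Sum as Sum
open import Data.Empty using (⊥; ⊥-elim)
open import Function using (_∘_)
open import Data.List using (List; []; _∷_; length; map; lookup; filter)
open import Data.List.Properties using (length-filter; filter-none; filter-reject)
open import Data.List.Membership.Propositional using (_∈_)
open import Data.List.Membership.Propositional.Properties using (∈-lookup; ∈-map⁻; ∈-filter⁺)
open import Data.List.Relation.Unary.Any using (here; there)
import Data.List.Relation.Unary.All as All
open import Data.List.Relation.Unary.Linked as Linked using (Linked)
open import Data.List.Relation.Unary.Linked.Properties using (Linked⇒All)
open import Data.List.Relation.Binary.Permutation.Propositional using (_↭_)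
open import Data.List.Relation.Binary.Permutation.Propositional.Properties using (↭-length; filter-↭; ∈-resp-↭)
open import Data.Maybe.Relation.Binary.Connected using (just)
open import Relation.Nullary using (¬_; yes; no; does)
open import Relation.Nullary.Decidable using (_×-dec_)
open import Relation.Unary using (Decidable)
open import Relation.Binary.PropositionalEquality using (_≡_; _≢_; refl; sym; trans; cong; subst; subst₂)

module _ {A : Set} (R : A → A → Set) where

  WalkWithin : A → A → ℕ → Set
  WalkWithin x y p = ∃ λ m → m ≤ p × Walk R x y m

  BothWithin : A → A → A → ℕ → Set
  BothWithin w x y p = WalkWithin w x p × WalkWithin w y p

module _ {A : Set} {R : A → A → Set} where

  within-mono : ∀ {x y p q} → p ≤ q → WalkWithin R x y p → WalkWithin R x y q
  within-mono p≤q (m , m≤p , w) = m , ≤-trans m≤p p≤q , w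

  snoc : ∀ {x y z k} → Walk R x y k → R y z → Walk R x z (suc k)
  snoc here e = step e here
  snoc (step e w) e′ = step e (snoc w e′)

  reverse : (∀ {x y} → R x y → R y x) → ∀ {x y k} → Walk R x y k → Walk R y x k
  reverse sym-R here = here
  reverse sym-R (step e w) = snoc (reverse sym-R w) (sym-R e)

  -- Adjacency is not decidable, so a shortest walk exists only up to double negation; this
  -- suffices because every use below is in a proof of ⊥.
  ¬¬-dist : ∀ {x y k} → Walk R x y k → ¬ ¬ ∃ (Dist R x y)
  ¬¬-dist {x} {y} {k} = <-rec (λ k → Walk R x y k → ¬ ¬ ∃ (Dist R x y)) least k
    where
    least : ∀ k → (∀ {m} → m < k → Walk R x y m → ¬ ¬ ∃ (Dist R x y)) →
            Walk R x y k → ¬ ¬ ∃ (Dist R x y)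
    least k shorter w none = none (k , w , minimal)
      where
      minimal : ∀ m → Walk R x y m → k ≤ m
      minimal m w′ with k ≤? m
      ... | yes k≤m = k≤m
      ... | no k≰m = ⊥-elim (shorter (≰⇒> k≰m) w′ none)

  ¬¬-withinDiameter : ∀ {D} → Connected R → IsDiameter R D → ∀ x y → ¬ ¬ WalkWithin R x y D
  ¬¬-withinDiameter conn (bounded , _) x y none =
    ¬¬-dist (proj₂ (conn x y)) λ (m , d) → none (m , bounded x y m d , proj₁ d)

  walk⇒step : ∀ {x y k} → x ≢ y → Walk R x y k → ∃ (R x)
  walk⇒step x≢y here = ⊥-elim (x≢y refl)
  walk⇒step _ (step e _) = _ , e

  within-step : ∀ {x y z p} → R x y → WalkWithin R y z p → WalkWithin R x z (suc p)
  within-step e (m , m≤p , w) = suc m , s≤s m≤p , step e w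

  -- Walk from w₁ until the remaining part is shorter than p₂: the edge just traversed works.
  -- Only a trivial walk (w₁ = w₂) has no such edge, and then any edge at w₁ will do.
  edge-between : (∀ {x y} → R x y → R y x) → (∀ x → ∃ (R x)) →
                ∀ {w₁ w₂ δ p₁ p₂} → 1 ≤ p₁ → 1 ≤ p₂ → δ < p₁ + p₂ → Walk R w₁ w₂ δ →
                ∃₂ λ x y → R x y × BothWithin R w₁ x y p₁ × BothWithin R w₂ x y p₂
  edge-between sym-R nbr {δ = δ} {suc q₁} {suc q₂} _ _ (s≤s δ≤) w =
    go q₁ q₂ w (subst (δ ≤_) (+-suc q₁ q₂) δ≤)
    where
    go : ∀ q₁ q₂ {w₁ w₂ δ} → Walk R w₁ w₂ δ → δ ≤ suc (q₁ + q₂) →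
         ∃₂ λ x y → R x y × BothWithin R w₁ x y (suc q₁) × BothWithin R w₂ x y (suc q₂)
    go q₁ q₂ {w₁} here _ =
      w₁ , proj₁ (nbr w₁) , proj₂ (nbr w₁) , (stay , edge) , (stay , edge)
      where
      stay : ∀ {p} → WalkWithin R w₁ w₁ p
      stay = 0 , z≤n , here
      edge : ∀ {p} → WalkWithin R w₁ (proj₁ (nbr w₁)) (suc p)
      edge = 1 , s≤s z≤n , step (proj₂ (nbr w₁)) here
    go q₁ q₂ (step {k = δ} e w) (s≤s δ≤) with δ ≤? q₂ | q₁
    ... | yes δ≤q₂ | _ =
      _ , _ , e , ((0 , z≤n , here) , (1 , s≤s z≤n , step e here)) ,
      ((suc δ , s≤s δ≤q₂ , reverse sym-R (step e w)) , (δ , m≤n⇒m≤1+n δ≤q₂ , reverse sym-R w))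
    ... | no δ≰q₂ | zero = ⊥-elim (δ≰q₂ δ≤)
    ... | no _ | suc q₁′ with go q₁′ q₂ w δ≤
    ...   | x , y , xy , (w₁x , w₁y) , near₂ =
      x , y , xy , (within-step e w₁x , within-step e w₁y) , near₂

module _ {A : Set} {P : A → Set} (P? : Decidable P) where

  atMostOne : A → ∀ {xs} → length (filter P? xs) ≤ 1 → ∃ λ a → ∀ {x} → x ∈ xs → P x → x ≡ a
  atMostOne a {xs} ≤1 =
    let a₀ , only = cover (filter P? xs) ≤1 in a₀ , λ x∈ px → only (∈-filter⁺ P? x∈ px)
    where
    cover : ∀ ys → length ys ≤ 1 → ∃ λ a → ∀ {x} → x ∈ ys → x ≡ a
    cover [] _ = a , λ ()
    cover (y ∷ []) _ = y , λ { (here refl) → refl }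
    cover (_ ∷ _ ∷ _) (s≤s ())

  atMostTwo : A → ∀ {xs} → length (filter P? xs) ≤ 2 →
              ∃₂ λ a b → ∀ {x} → x ∈ xs → P x → x ≡ a ⊎ x ≡ b
  atMostTwo a {xs} ≤2 =
    let a₀ , a₁ , only = cover (filter P? xs) ≤2 in a₀ , a₁ , λ x∈ px → only (∈-filter⁺ P? x∈ px)
    where
    cover : ∀ ys → length ys ≤ 2 → ∃₂ λ a b → ∀ {x} → x ∈ ys → x ≡ a ⊎ x ≡ b
    cover [] _ = a , a , λ ()
    cover (y ∷ []) _ = y , y , λ { (here refl) → inj₁ refl }
    cover (y ∷ z ∷ []) _ = y , z , λ { (here refl) → inj₁ refl ; (there (here refl)) → inj₂ refl }
    cover (_ ∷ _ ∷ _ ∷ _) (s≤s (s≤s ()))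

  length-filter-map : ∀ {B : Set} (f : B → A) xs →
                      length (filter P? (map f xs)) ≡ length (filter (P? ∘ f) xs)
  length-filter-map f [] = refl
  length-filter-map f (x ∷ xs) with does (P? (f x))
  ... | true = cong suc (length-filter-map f xs)
  ... | false = length-filter-map f xs

module _ {P : ℕ → Set} (P? : Decidable P) where

  head≤lookup : ∀ {y ys} → Linked _≤_ (y ∷ ys) → ∀ k → y ≤ lookup (y ∷ ys) k
  head≤lookup sorted = Linked.lookup ≤-trans sorted (just ≤-refl)

  head-rejected : ∀ {y ys} → Linked _≤_ (y ∷ ys) → ∀ k → (∀ {x} → P x → lookup (y ∷ ys) k < x) →
                  filter P? (y ∷ ys) ≡ filter P? ys
  head-rejected sorted k above = filter-reject P? λ py → <⇒≱ (above py) (head≤lookup sorted k)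

  filter-below : ∀ {xs} → Linked _≤_ xs → (k : Fin (length xs)) → (∀ {x} → P x → x < lookup xs k) →
                 length (filter P? xs) ≤ toℕ k
  filter-below {_ ∷ _} sorted fzero below =
    ≤-reflexive (cong length (filter-none P? (All.map (λ y≤x px → <⇒≱ (below px) y≤x)
                                                       (Linked⇒All ≤-trans ≤-refl sorted))))
  filter-below {y ∷ _} sorted (fsuc k) below with P? y
  ... | yes _ = s≤s (filter-below (Linked.tail sorted) k below)
  ... | no _ = m≤n⇒m≤1+n (filter-below (Linked.tail sorted) k below)

  filter-above : ∀ {xs} → Linked _≤_ xs → (k : Fin (length xs)) → (∀ {x} → P x → lookup xs k < x) →
                 length (filter P? xs) + toℕ k < length xs
  filter-above {_ ∷ ys} sorted fzero above rewrite head-rejected sorted fzero above =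
    s≤s (subst (_≤ length ys) (sym (+-identityʳ _)) (length-filter P? ys))
  filter-above {_ ∷ ys} sorted (fsuc k) above rewrite head-rejected sorted (fsuc k) above =
    subst (_< suc (length ys)) (sym (+-suc _ _)) (s≤s (filter-above (Linked.tail sorted) k above))

  filter-between : ∀ {xs} → Linked _≤_ xs → (i j : Fin (length xs)) → toℕ i < toℕ j →
                   (∀ {x} → P x → lookup xs i < x × x < lookup xs j) →
                   length (filter P? xs) + toℕ i < toℕ j
  filter-between {_ ∷ _} sorted fzero (fsuc j) _ between
    rewrite head-rejected sorted fzero (proj₁ ∘ between) =
    s≤s (subst (_≤ toℕ j) (sym (+-identityʳ _)) (filter-below (Linked.tail sorted) j (proj₂ ∘ between)))
  filter-between {_ ∷ _} sorted (fsuc i) (fsuc j) (s≤s i<j) between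
    rewrite head-rejected sorted (fsuc i) (proj₁ ∘ between) =
    subst (_< suc (toℕ j)) (sym (+-suc _ _)) (s≤s (filter-between (Linked.tail sorted) i j i<j between))

connected⇒neighbour : ∀ {n} (G : Graph (suc (suc n))) → Connected (Adj G) → ∀ w → ∃ (Adj G w)
connected⇒neighbour G conn fzero = walk⇒step (λ ()) (proj₂ (conn fzero (fsuc fzero)))
connected⇒neighbour G conn (fsuc w) = walk⇒step (λ ()) (proj₂ (conn (fsuc w) fzero))

module _ {t : ℕ} where

  PathAdj-sym : ∀ {a c} → PathAdj t a c → PathAdj t c a
  PathAdj-sym = Sum.swap

  ∣n-1+n∣≡1 : ∀ n → ∣ n - suc n ∣ ≡ 1
  ∣n-1+n∣≡1 n = trans (m≤n⇒∣m-n∣≡n∸m (n≤1+n n)) (m+n∸n≡m 1 n)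

  PathAdj⇒∣-∣≡1 : ∀ {a c} → PathAdj t a c → ∣ toℕ a - toℕ c ∣ ≡ 1
  PathAdj⇒∣-∣≡1 {a} (inj₁ e) rewrite sym e = ∣n-1+n∣≡1 (toℕ a)
  PathAdj⇒∣-∣≡1 {c = c} (inj₂ e) rewrite sym e = trans (∣-∣-comm (suc (toℕ c)) (toℕ c)) (∣n-1+n∣≡1 (toℕ c))

  pathWalkUp : ∀ p (j r : Fin t) → toℕ j + p ≡ toℕ r → Walk (PathAdj t) j r p
  pathWalkUp zero j r e =
    subst (λ r → Walk (PathAdj t) j r 0) (toℕ-injective (trans (sym (+-identityʳ (toℕ j))) e)) here
  pathWalkUp (suc p) j r e =
    step (inj₁ (sym (toℕ-fromℕ< j+1<t)))
         (pathWalkUp p (fromℕ< j+1<t) r (trans (cong (_+ p) (toℕ-fromℕ< j+1<t)) e′))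
    where
    e′ : suc (toℕ j + p) ≡ toℕ r
    e′ = trans (sym (+-suc (toℕ j) p)) e
    j+1<t : suc (toℕ j) < t
    j+1<t = ≤-<-trans (s≤s (m≤m+n (toℕ j) p)) (subst (_< t) (sym e′) (toℕ<n r))

  pathWalk : (j r : Fin t) → Walk (PathAdj t) j r ∣ toℕ j - toℕ r ∣
  pathWalk j r with ≤-total (toℕ j) (toℕ r)
  ... | inj₁ j≤r = subst (Walk (PathAdj t) j r) (sym (m≤n⇒∣m-n∣≡n∸m j≤r))
                         (pathWalkUp _ j r (m+[n∸m]≡n j≤r))
  ... | inj₂ r≤j = subst (Walk (PathAdj t) j r) (sym (m≤n⇒∣n-m∣≡n∸m r≤j))
                         (reverse PathAdj-sym (pathWalkUp _ r j (m+[n∸m]≡n r≤j)))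

row : ∀ {t n} → Fin t × Fin n → ℕ
row = toℕ ∘ proj₁

rowGap : ∀ {t n} → Fin t × Fin n → Fin t → ℕ
rowGap s r = ∣ row s - toℕ r ∣

m+n≤o⇒n≤∣o-m∣ : ∀ {m n o} → m + n ≤ o → n ≤ ∣ o - m ∣
m+n≤o⇒n≤∣o-m∣ {m} {n} {o} m+n≤o =
  ≤-trans (m+n≤o⇒m≤o∸n n (subst (_≤ o) (+-comm m n) m+n≤o)) (m∸n≤∣m-n∣ o m)

m+n≤o⇒n≤∣m-o∣ : ∀ {m n o} → m + n ≤ o → n ≤ ∣ m - o ∣
m+n≤o⇒n≤∣m-o∣ {m} {n} {o} m+n≤o = subst (n ≤_) (∣-∣-comm o m) (m+n≤o⇒n≤∣o-m∣ m+n≤o)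

clear⇒far : ∀ {D a j} → j + D ≤ a ⊎ suc a + D ≤ j → D ≤ ∣ j - a ∣ × D ≤ ∣ j - suc a ∣
clear⇒far (inj₁ below) = m+n≤o⇒n≤∣m-o∣ below , m+n≤o⇒n≤∣m-o∣ (m≤n⇒m≤1+n below)
clear⇒far {D} {a} (inj₂ above) =
  m+n≤o⇒n≤∣o-m∣ (≤-trans (+-monoˡ-≤ D (n≤1+n a)) above) , m+n≤o⇒n≤∣o-m∣ above

m∸n≰o⇒o+n<m : ∀ {m n o} → ¬ (m ∸ n ≤ o) → o + n < m
m∸n≰o⇒o+n<m {m} {n} {o} m∸n≰o with o + n <? m
... | yes o+n<m = o+n<m
... | no o+n≮m = ⊥-elim (m∸n≰o (m≤n+o⇒m∸n≤o m n (subst (m ≤_) (+-comm o n) (≮⇒≥ o+n≮m))))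

m+n≤o⇒o<[1+o∸m]+[1+o∸n] : ∀ {m n o} → m + n ≤ o → n ≤ suc o → o < (suc o ∸ m) + (suc o ∸ n)
m+n≤o⇒o<[1+o∸m]+[1+o∸n] {m} {n} {o} m+n≤o n≤1+o = begin-strict
  o                        <⟨ n<1+n o ⟩
  suc o                    ≡⟨ sym (m+[n∸m]≡n n≤1+o) ⟩
  n + (suc o ∸ n)          <⟨ +-monoˡ-< (suc o ∸ n) n<1+o∸m ⟩
  (suc o ∸ m) + (suc o ∸ n) ∎
  where
  open ≤-Reasoning
  n<1+o∸m : n < suc o ∸ m
  n<1+o∸m = m+n≤o⇒m≤o∸n (suc n) (s≤s (subst (_≤ o) (+-comm m n) m+n≤o))

1≤n⇒0<n+n : ∀ {n} → 1 ≤ n → 0 < n + n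
1≤n⇒0<n+n {n} 1≤n = ≤-trans 1≤n (m≤m+n n n)

m+n<2+n⇒m≤1 : ∀ {m n} → m + n < 2 + n → m ≤ 1
m+n<2+n⇒m≤1 {m} {n} = ≤-pred ∘ +-cancelʳ-< n m 2

1+n+n≡2n+1 : ∀ n → suc n + n ≡ 2 * n + 1
1+n+n≡2n+1 = solve-∀

1+n≤2n+1 : ∀ n → suc n ≤ 2 * n + 1
1+n≤2n+1 n = subst (suc n ≤_) (1+n+n≡2n+1 n) (m≤m+n (suc n) n)

1+[m+n]+n≡2n+[1+m] : ∀ m n → suc (m + n) + n ≡ 2 * n + suc m
1+[m+n]+n≡2n+[1+m] = solve-∀

module _ {t n : ℕ} (G : Graph n) where

  productWalk : ∀ {j r w x p m} → Walk (PathAdj t) j r p → Walk (Adj G) w x m → m ≤ p →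
                Walk (StrongAdj t G) (j , w) (r , x) p
  productWalk here here _ = here
  productWalk (step a ws) here _ = step (inj₂ (inj₁ (refl , a))) (productWalk ws here z≤n)
  productWalk (step a ws) (step e wg) (s≤s m≤p) = step (inj₂ (inj₂ (a , e))) (productWalk ws wg m≤p)

  rowGap-step : ∀ {j j′ w w′} → StrongAdj t G (j , w) (j′ , w′) → ∣ toℕ j - toℕ j′ ∣ ≤ 1
  rowGap-step {j} (inj₁ (refl , _)) = ≤-trans (≤-reflexive (∣n-n∣≡0 (toℕ j))) z≤n
  rowGap-step (inj₂ (inj₁ (_ , a))) = ≤-reflexive (PathAdj⇒∣-∣≡1 a)
  rowGap-step (inj₂ (inj₂ (a , _))) = ≤-reflexive (PathAdj⇒∣-∣≡1 a)

  rowGap≤length : ∀ {j r w x k} → Walk (StrongAdj t G) (j , w) (r , x) k → ∣ toℕ j - toℕ r ∣ ≤ k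
  rowGap≤length {j} here = ≤-reflexive (∣n-n∣≡0 (toℕ j))
  rowGap≤length {j} {r} (step {y = j′ , _} e w) =
    ≤-trans (∣-∣-triangle (toℕ j) (toℕ j′) (toℕ r)) (+-mono-≤ (rowGap-step e) (rowGap≤length w))

  dist≡rowGap : ∀ {j r w x m k} → Walk (Adj G) w x m → m ≤ ∣ toℕ j - toℕ r ∣ →
                Dist (StrongAdj t G) (j , w) (r , x) k → k ≡ ∣ toℕ j - toℕ r ∣
  dist≡rowGap {j} {r} wg m≤gap (wp , minimal) =
    ≤-antisym (minimal _ (productWalk (pathWalk j r) wg m≤gap)) (rowGap≤length wp)

  sameRowEdge⇒¬generator : ∀ {S} (r : Fin t) {x y} → Adj G x y →
    (∀ {s} → s ∈ S → ¬ ¬ BothWithin (Adj G) (proj₂ s) x y (rowGap s r)) →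
    ¬ LocalMetricGenerator (StrongAdj t G) S
  sameRowEdge⇒¬generator r {x} {y} xy shadowed gen with gen (r , x) (r , y) (inj₁ (refl , xy))
  ... | s , s∈S , _ , _ , d₁ , d₂ , k₁≢k₂ =
    shadowed s∈S λ ((_ , m₁≤ , w₁) , (_ , m₂≤ , w₂)) →
      k₁≢k₂ (trans (dist≡rowGap w₁ m₁≤ d₁) (sym (dist≡rowGap w₂ m₂≤ d₂)))

  module Exceptions (nbr : ∀ w → ∃ (Adj G w)) (D : ℕ)
                    (within : ∀ w x → ¬ ¬ WalkWithin (Adj G) w x D) where

    far⇒¬¬BothWithin : ∀ {w x y p} → D ≤ p → ¬ ¬ BothWithin (Adj G) w x y p
    far⇒¬¬BothWithin {w} {x} {y} D≤p none =
      within w x λ wx → within w y λ wy → none (within-mono D≤p wx , within-mono D≤p wy)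

    twoExceptions : ∀ {S} (r : Fin t) (s₁ s₂ : Fin t × Fin n) {δ} →
      1 ≤ rowGap s₁ r → 1 ≤ rowGap s₂ r → δ < rowGap s₁ r + rowGap s₂ r →
      ¬ ¬ WalkWithin (Adj G) (proj₂ s₁) (proj₂ s₂) δ →
      (∀ {s} → s ∈ S → s ≡ s₁ ⊎ s ≡ s₂ ⊎ D ≤ rowGap s r) →
      ¬ LocalMetricGenerator (StrongAdj t G) S
    twoExceptions {S} r s₁ s₂ p₁≥1 p₂≥1 δ<p₁+p₂ ¬¬walk covered gen =
      ¬¬walk λ (_ , δ′≤δ , w) →
        unresolved (edge-between (symmetric G) nbr p₁≥1 p₂≥1 (≤-<-trans δ′≤δ δ<p₁+p₂) w)
      where
      unresolved : (∃₂ λ x y → Adj G x y × BothWithin (Adj G) (proj₂ s₁) x y (rowGap s₁ r)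
                                          × BothWithin (Adj G) (proj₂ s₂) x y (rowGap s₂ r)) → ⊥
      unresolved (x , y , xy , near₁ , near₂) = sameRowEdge⇒¬generator r xy shadowed gen
        where
        shadowed : ∀ {s} → s ∈ S → ¬ ¬ BothWithin (Adj G) (proj₂ s) x y (rowGap s r)
        shadowed s∈S with covered s∈S
        ... | inj₁ refl = λ none → none near₁
        ... | inj₂ (inj₁ refl) = λ none → none near₂
        ... | inj₂ (inj₂ far) = far⇒¬¬BothWithin far

    oneExceptionInRow : ∀ {S} (r : Fin t) (s₀ : Fin t × Fin n) → 1 ≤ rowGap s₀ r →
      (∀ {s} → s ∈ S → s ≡ s₀ ⊎ D ≤ rowGap s r) →
      ¬ LocalMetricGenerator (StrongAdj t G) S
    oneExceptionInRow r s₀ gap≥1 covered =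
      twoExceptions r s₀ s₀ gap≥1 gap≥1 (1≤n⇒0<n+n gap≥1) (λ none → none (0 , z≤n , here))
        (Sum.map₂ inj₂ ∘ covered)

    oneException : ∀ {S} (r₀ r₁ : Fin t) → PathAdj t r₀ r₁ → (s₀ : Fin t × Fin n) →
      (∀ {s} → s ∈ S → s ≡ s₀ ⊎ D ≤ rowGap s r₀ × D ≤ rowGap s r₁) →
      ¬ LocalMetricGenerator (StrongAdj t G) S
    oneException r₀ r₁ r₀r₁ s₀@(j₀ , _) covered with j₀ Fin.≟ r₀
    ... | yes refl = oneExceptionInRow r₁ s₀ (≤-reflexive (sym (PathAdj⇒∣-∣≡1 r₀r₁)))
                       (Sum.map₂ proj₂ ∘ covered)
    ... | no j₀≢r₀ = oneExceptionInRow r₀ s₀ (n≢0⇒n>0 (j₀≢r₀ ∘ toℕ-injective ∘ ∣m-n∣≡0⇒m≡n))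
                       (Sum.map₂ proj₁ ∘ covered)

    oneExceptionAt : ∀ {S} a → suc a < t → (s₀ : Fin t × Fin n) →
      (∀ {s} → s ∈ S → s ≡ s₀ ⊎ (row s + D ≤ a ⊎ suc a + D ≤ row s)) →
      ¬ LocalMetricGenerator (StrongAdj t G) S
    oneExceptionAt a a+1<t s₀ covered =
      oneException r₀ r₁ r₀r₁ s₀ λ {s} s∈S → Sum.map₂ (far {s}) (covered s∈S)
      where
      a<t : a < t
      a<t = <-trans (n<1+n a) a+1<t
      r₀ r₁ : Fin t
      r₀ = fromℕ< a<t
      r₁ = fromℕ< a+1<t
      r₀r₁ : PathAdj t r₀ r₁
      r₀r₁ = inj₁ (trans (cong suc (toℕ-fromℕ< a<t)) (sym (toℕ-fromℕ< a+1<t)))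
      far : ∀ {s : Fin t × Fin n} → row s + D ≤ a ⊎ suc a + D ≤ row s →
            D ≤ rowGap s r₀ × D ≤ rowGap s r₁
      far clear rewrite toℕ-fromℕ< a<t | toℕ-fromℕ< a+1<t = clear⇒far clear

    twoExceptionsAt : ∀ {S} a → a < t → (s₁ s₂ : Fin t × Fin n) →
      1 ≤ ∣ row s₁ - a ∣ → 1 ≤ ∣ row s₂ - a ∣ → D < ∣ row s₁ - a ∣ + ∣ row s₂ - a ∣ →
      (∀ {s} → s ∈ S → s ≡ s₁ ⊎ s ≡ s₂ ⊎ D ≤ ∣ row s - a ∣) →
      ¬ LocalMetricGenerator (StrongAdj t G) S
    twoExceptionsAt a a<t s₁ s₂ gap₁≥1 gap₂≥1 D<gap₁+gap₂ covered =
      twoExceptions r s₁ s₂ (subst (1 ≤_) (sym (gap≡ s₁)) gap₁≥1) (subst (1 ≤_) (sym (gap≡ s₂)) gap₂≥1)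
        (subst₂ (λ g₁ g₂ → D < g₁ + g₂) (sym (gap≡ s₁)) (sym (gap≡ s₂)) D<gap₁+gap₂)
        (within (proj₂ s₁) (proj₂ s₂))
        (λ {s} s∈S → Sum.map₂ (Sum.map₂ (subst (D ≤_) (sym (gap≡ s)))) (covered s∈S))
      where
      r : Fin t
      r = fromℕ< a<t
      gap≡ : ∀ s → rowGap s r ≡ ∣ row s - a ∣
      gap≡ s = cong (∣ row s -_∣) (toℕ-fromℕ< a<t)

module Bounds {t′ n′ : ℕ} (G : Graph (suc (suc n′))) (conn : Connected (Adj G))
              {D : ℕ} (diam : IsDiameter (Adj G) D)
              {B : List (Fin (suc (suc t′)) × Fin (suc (suc n′)))}
              (gen : LocalMetricGenerator (StrongAdj (suc (suc t′)) G) B)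
              {is : List ℕ} (perm : is ↭ map firstIndex B) (sorted : Linked _≤_ is) where

  t : ℕ
  t = suc (suc t′)

  V : Set
  V = Fin t × Fin (suc (suc n′))

  open Exceptions {t} G (connected⇒neighbour G conn) D (¬¬-withinDiameter conn diam)

  firstIndex-of : ∀ {i} → i ∈ is → ∃ λ s → s ∈ B × i ≡ firstIndex s
  firstIndex-of i∈is = ∈-map⁻ firstIndex (∈-resp-↭ perm i∈is)

  lookup≤t : ∀ k → lookup is k ≤ t
  lookup≤t k with firstIndex-of (∈-lookup k)
  ... | s , _ , e = subst (_≤ t) (sym e) (toℕ<n (proj₁ s))

  length-filter-is : ∀ {P : ℕ → Set} (P? : Decidable P) →
                     length (filter P? is) ≡ length (filter (P? ∘ firstIndex) B)
  length-filter-is P? = trans (↭-length (filter-↭ P? perm)) (length-filter-map P? firstIndex B)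

  atMostOneNear⇒⊥ : ∀ {P : ℕ → Set} (P? : Decidable P) → length (filter P? is) ≤ 1 → ∀ a → suc a < t →
            (∀ (s : V) → ¬ P (firstIndex s) → row s + D ≤ a ⊎ suc a + D ≤ row s) → ⊥
  atMostOneNear⇒⊥ P? ≤1 a a+1<t clear
    with atMostOne (P? ∘ firstIndex) (fzero , fzero) (subst (_≤ 1) (length-filter-is P?) ≤1)
  ... | s₀ , near⇒s₀ = oneExceptionAt a a+1<t s₀ covered gen
    where
    covered : ∀ {s} → s ∈ B → s ≡ s₀ ⊎ (row s + D ≤ a ⊎ suc a + D ≤ row s)
    covered {s} s∈B with P? (firstIndex s)
    ... | yes near = inj₁ (near⇒s₀ s∈B near)
    ... | no far = inj₂ (clear s far)

  second≤D+1 : ∀ k → toℕ k ≡ 1 → lookup is k ≤ D + 1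
  second≤D+1 k k≡1 with lookup is k ≤? D + 1
  ... | yes ok = ok
  ... | no big = ⊥-elim (atMostOneNear⇒⊥ (_≤? D + 1) count≤1 0 (s≤s (s≤s z≤n)) clear)
    where
    count≤1 : length (filter (_≤? D + 1) is) ≤ 1
    count≤1 = subst (_ ≤_) k≡1 (filter-below (_≤? D + 1) sorted k λ x≤D+1 → ≤-<-trans x≤D+1 (≰⇒> big))
    clear : ∀ (s : V) → ¬ (firstIndex s ≤ D + 1) → row s + D ≤ 0 ⊎ 1 + D ≤ row s
    clear s far = inj₂ (subst (_≤ row s) (+-comm D 1) (≤-pred (≰⇒> far)))

  penultimate≥t∸D : ∀ k → suc (suc (toℕ k)) ≡ length is → t ∸ D ≤ lookup is k
  penultimate≥t∸D k k+2≡len with t ∸ D ≤? lookup is k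
  ... | yes ok = ok
  ... | no small = ⊥-elim (atMostOneNear⇒⊥ (t ∸ D ≤?_) count≤1 t′ ≤-refl clear)
    where
    count≤1 : length (filter (t ∸ D ≤?_) is) ≤ 1
    count≤1 = m+n<2+n⇒m≤1 (<-≤-trans (filter-above (t ∸ D ≤?_) sorted k λ t∸D≤x → <-≤-trans (≰⇒> small) t∸D≤x)
                                     (≤-reflexive (sym k+2≡len)))
    clear : ∀ (s : V) → ¬ (t ∸ D ≤ firstIndex s) → row s + D ≤ t′ ⊎ suc t′ + D ≤ row s
    clear s far = inj₁ (≤-pred (≤-pred (m∸n≰o⇒o+n<m far)))

  InWindow : ℕ → ℕ → Set
  InWindow v x = v < x × x ≤ 2 * D + v

  inWindow? : ∀ v → Decidable (InWindow v)
  inWindow? v x = (v <? x) ×-dec (x ≤? 2 * D + v)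

  thinWindow⇒⊥ : ∀ r → length (filter (inWindow? (suc r)) is) ≤ 1 → 2 * D + suc r < t → ⊥
  thinWindow⇒⊥ r count≤1 window<t = atMostOneNear⇒⊥ (inWindow? (suc r)) count≤1 (r + D) a+1<t clear
    where
    a+1<t : suc (r + D) < t
    a+1<t = ≤-trans (s≤s (subst (suc (r + D) ≤_) (1+[m+n]+n≡2n+[1+m] r D) (m≤m+n _ D))) window<t
    clear : ∀ (s : V) → ¬ InWindow (suc r) (firstIndex s) →
            row s + D ≤ r + D ⊎ suc (r + D) + D ≤ row s
    clear s out with suc r <? firstIndex s
    ... | no below = inj₁ (+-monoˡ-≤ D (≤-pred (≮⇒≥ below)))
    ... | yes above = inj₂ (subst (_≤ row s) (sym (1+[m+n]+n≡2n+[1+m] r D))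
                              (≤-pred (≰⇒> λ inside → out (above , inside))))

  window : ∀ k k′ → toℕ k′ ≡ toℕ k + 2 → lookup is k′ ≤ 2 * D + lookup is k
  window k k′ k′≡k+2 with lookup is k′ ≤? 2 * D + lookup is k | firstIndex-of (∈-lookup k)
  ... | yes ok | _ = ok
  ... | no big | s , _ , v≡ =
    ⊥-elim (thinWindow⇒⊥ (row s) (subst (λ v → length (filter (inWindow? v) is) ≤ 1) v≡ count≤1)
                                (subst (λ v → 2 * D + v < t) v≡ (<-≤-trans (≰⇒> big) (lookup≤t k′))))
    where
    count≤1 : length (filter (inWindow? (lookup is k)) is) ≤ 1
    count≤1 = m+n<2+n⇒m≤1 (<-≤-trans (filter-between (inWindow? (lookup is k)) sorted k k′ k<k′
                                        λ (v<x , x≤) → v<x , ≤-<-trans x≤ (≰⇒> big))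
                                     (≤-reflexive (trans k′≡k+2 (+-comm (toℕ k) 2))))
      where
      k<k′ : toℕ k < toℕ k′
      k<k′ = subst (toℕ k <_) (sym k′≡k+2) (m<m+n (toℕ k) (s≤s z≤n))

  LowExceptions : V → V → Set
  LowExceptions s₁ s₂ = ∀ {s} → s ∈ B → firstIndex s ≤ 2 * D + 1 → s ≡ s₁ ⊎ s ≡ s₂

  oneHigh⇒⊥ : ∀ s₁ s₂ → suc D ≤ row s₁ → LowExceptions s₁ s₂ → ⊥
  oneHigh⇒⊥ s₁ s₂ high only = oneExceptionAt 0 (s≤s (s≤s z≤n)) s₂ covered gen
    where
    covered : ∀ {s} → s ∈ B → s ≡ s₂ ⊎ (row s + D ≤ 0 ⊎ 1 + D ≤ row s)
    covered {s} s∈B with firstIndex s ≤? 2 * D + 1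
    ... | no far = inj₂ (inj₂ (≤-trans (1+n≤2n+1 D) (≤-pred (≰⇒> far))))
    ... | yes near with only s∈B near
    ...   | inj₁ refl = inj₂ (inj₂ high)
    ...   | inj₂ refl = inj₁ refl

  lowExceptionsOrFar : ∀ {s₁ s₂ a} → LowExceptions s₁ s₂ → (∀ {j} → 2 * D + 1 ≤ j → D ≤ ∣ j - a ∣) →
               ∀ {s} → s ∈ B → s ≡ s₁ ⊎ s ≡ s₂ ⊎ D ≤ ∣ row s - a ∣
  lowExceptionsOrFar only far-from-a {s} s∈B with firstIndex s ≤? 2 * D + 1
  ... | yes low = Sum.map₂ inj₁ (only s∈B low)
  ... | no high = inj₂ (inj₂ (far-from-a (≤-pred (≰⇒> high))))

  bothLow⇒⊥ : ∀ s₁ s₂ → row s₁ ≤ D → row s₂ ≤ D → LowExceptions s₁ s₂ → 2 * D + 1 < t → ⊥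
  bothLow⇒⊥ s₁ s₂ low₁ low₂ only 2D+1<t with suc D ≤? row s₁ + row s₂
  ... | yes wide =
    twoExceptionsAt 0 (s≤s z≤n) s₁ s₂
      (m+n≤o⇒n≤∣o-m∣ (+-cancelʳ-< (row s₂) 0 (row s₁) (≤-<-trans low₂ wide)))
      (m+n≤o⇒n≤∣o-m∣ (+-cancelˡ-< (row s₁) 0 (row s₂)
                        (subst (_< row s₁ + row s₂) (sym (+-identityʳ (row s₁))) (≤-<-trans low₁ wide))))
      (subst₂ (λ g₁ g₂ → D < g₁ + g₂) (sym (∣-∣-identityʳ (row s₁))) (sym (∣-∣-identityʳ (row s₂))) wide)
      (lowExceptionsOrFar only λ 2D+1≤j → m+n≤o⇒n≤∣o-m∣ (≤-trans (≤-trans (n≤1+n D) (1+n≤2n+1 D)) 2D+1≤j)) gen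
  ... | no narrow =
    twoExceptionsAt (suc D) (≤-trans (s≤s (1+n≤2n+1 D)) 2D+1<t) s₁ s₂
      (m+n≤o⇒n≤∣m-o∣ (subst (_≤ suc D) (+-comm 1 (row s₁)) (s≤s low₁)))
      (m+n≤o⇒n≤∣m-o∣ (subst (_≤ suc D) (+-comm 1 (row s₂)) (s≤s low₂)))
      (subst₂ (λ g₁ g₂ → D < g₁ + g₂)
        (sym (m≤n⇒∣m-n∣≡n∸m (m≤n⇒m≤1+n low₁))) (sym (m≤n⇒∣m-n∣≡n∸m (m≤n⇒m≤1+n low₂)))
        (m+n≤o⇒o<[1+o∸m]+[1+o∸n] (≤-pred (≰⇒> narrow)) (m≤n⇒m≤1+n low₂)))
      (lowExceptionsOrFar only λ {j} 2D+1≤j → m+n≤o⇒n≤∣o-m∣ (subst (_≤ j) (sym (1+n+n≡2n+1 D)) 2D+1≤j)) gen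

  atMostTwoLow⇒⊥ : length (filter (_≤? 2 * D + 1) is) ≤ 2 → 2 * D + 1 < t → ⊥
  atMostTwoLow⇒⊥ count≤2 2D+1<t with atMostTwo ((_≤? 2 * D + 1) ∘ firstIndex) (fzero , fzero)
                                        (subst (_≤ 2) (length-filter-is (_≤? 2 * D + 1)) count≤2)
  ... | s₁ , s₂ , only with suc D ≤? row s₁ | suc D ≤? row s₂
  ...   | yes high₁ | _ = oneHigh⇒⊥ s₁ s₂ high₁ only
  ...   | _ | yes high₂ = oneHigh⇒⊥ s₂ s₁ high₂ λ s∈B near → Sum.swap (only s∈B near)
  ...   | no low₁ | no low₂ = bothLow⇒⊥ s₁ s₂ (≤-pred (≰⇒> low₁)) (≤-pred (≰⇒> low₂)) only 2D+1<t

  third≤2D+1 : ∀ k → toℕ k ≡ 2 → lookup is k ≤ 2 * D + 1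
  third≤2D+1 k k≡2 with lookup is k ≤? 2 * D + 1
  ... | yes ok = ok
  ... | no big = ⊥-elim (atMostTwoLow⇒⊥ count≤2 (<-≤-trans (≰⇒> big) (lookup≤t k)))
    where
    count≤2 : length (filter (_≤? 2 * D + 1) is) ≤ 2
    count≤2 = subst (_ ≤_) k≡2 (filter-below (_≤? 2 * D + 1) sorted k λ x≤ → ≤-<-trans x≤ (≰⇒> big))

lemma15 : (n : ℕ) (G : Graph n) → 2 ≤ n → Connected (Adj G) →
          (D : ℕ) → IsDiameter (Adj G) D →
          (t : ℕ) → 2 ≤ t →
          (B : List (Fin t × Fin n)) → LocalMetricBasis (StrongAdj t G) B →
          (is : List ℕ) → is ↭ map firstIndex B → Linked _≤_ is →
          ((k : Fin (length is)) → toℕ k ≡ 1 → lookup is k ≤ D + 1)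
          × ((k : Fin (length is)) → suc (suc (toℕ k)) ≡ length is → t ∸ D ≤ lookup is k)
          × ((k k′ : Fin (length is)) → toℕ k′ ≡ toℕ k + 2 → lookup is k′ ≤ 2 * D + lookup is k)
          × ((k : Fin (length is)) → toℕ k ≡ 2 → lookup is k ≤ 2 * D + 1)
lemma15 (suc (suc _)) G (s≤s (s≤s z≤n)) conn D diam (suc (suc _)) (s≤s (s≤s z≤n))
        B (gen , _) is perm sorted =
  second≤D+1 , penultimate≥t∸D , window , third≤2D+1
  where open Bounds G conn diam gen perm sorted
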